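{- Let $a_1,a_2,b_1,b_2\in\mathbb{Z}$ and let $S_{A,B}=S_{a_1,a_2,b_1,b_2}=\bigl(xyz=x^3+y^3+1+a_2x^2+a_1x+b_2y^2+b_1y\bigr)\subset\mathbb{A}^3$, i.e. $A(x)=x^3+a_2x^2+a_1x+1$, $B(y)=y^3+b_2y^2+b_1y+1$. If $\max\{|a_2|+|a_1|,\ |b_2|+|b_1|\}\ge 7$, then there is a trivial solution $p_0=(\pm1,\pm1,z_0)$ of one of the companion equations such that the $\Sigma_{A,B}$-orbit of $p_0$ is infinite.
   Context: Set $\bar A(x):=x^3A(x^{ -1})$, $\bar B(y):=y^3B(y^{ -1})$; for $P,Q$ of this shape $S_{P,Q}$ denotes $xyz=P(x)+Q(y)-1$. The companion surfaces (equations) of $S_{A,B}$ are $S_{A,B},S_{\bar A,B},S_{A,\bar B},S_{\bar A,\bar B}$ (equivalently, obtained by swapping $a_1\leftrightarrow a_2$ and/or $b_1\leftrightarrow b_2$). A trivial solution is an integer point $(x_0,y_0,z_0)$ with $x_0,y_0\in\{1,-1\}$. There are isomorphisms $\sigma_x:S_{P,Q}\to S_{P,\bar Q}$ and $\sigma_y:S_{P,Q}\to S_{\bar P,Q}$, given by $\sigma_x(x,y,z)=(x,\ xz-\sum_{j\ge1}q_jy^{j-1},\ z')$ and $\sigma_y(x,y,z)=(yz-\sum_{i\ge1}p_ix^{i-1},\ y,\ z'')$ where $P=\sum p_ix^i$, $Q=\sum q_jy^j$ and the third coordinate is determined by the target equation; on $xy\neq0$ they act on $(x,y)$ by $(x,y)\mapsto(x,P(x)/y)$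 and $(x,y)\mapsto(Q(y)/x,y)$ respectively. $\Sigma_{A,B}$ is the groupoid generated by these eight isomorphisms among the four companion surfaces; the $\Sigma_{A,B}$-orbit of a point is the set of images of it under all compositions of these maps. -}

module Defs where

open import Data.Bool using (Bool; true; false; if_then_else_)
open import Data.Integer using (ℤ; +_; -_; _+_; _-_; _*_)
open import Data.Product using (_×_; _,_; ∃; Σ)
open import Data.List using (List)
open import Data.List.Membership.Propositional using (_∈_)
open import Relation.Binary.PropositionalEquality using (_≡_)
open import Relation.Binary.Construct.Closure.ReflexiveTransitive using (Star)

record Coeffs : Set where
  constructor coeffs
  field
    p₁ p₂ q₁ q₂ : ℤ
open Coeffs public

Point : Set
Point = ℤ × ℤ × ℤ

polyP : Coeffs → ℤ → ℤ
polyP c x = x * x * x + p₂ c * x * x + p₁ c * x + + 1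

polyQ : Coeffs → ℤ → ℤ
polyQ c y = y * y * y + q₂ c * y * y + q₁ c * y + + 1

OnSurface : Coeffs → Point → Set
OnSurface c (x , y , z) = x * y * z ≡ polyP c x + polyQ c y - + 1

barP : Coeffs → Coeffs
barP (coeffs a b c d) = coeffs b a c d

barQ : Coeffs → Coeffs
barQ (coeffs a b c d) = coeffs a b d c

surf : ℤ → ℤ → ℤ → ℤ → Coeffs
surf a₁ a₂ b₁ b₂ = coeffs a₁ a₂ b₁ b₂

companion : Coeffs → Bool → Bool → Coeffs
companion c sA sB = (if sB then barQ else (λ d → d)) ((if sA then barP else (λ d → d)) c)

-- A labelled point: a point together with the (companion) surface it lies on.
LPoint : Set
LPoint = Coeffs × Point

-- σ_x : S_{P,Q} → S_{P,bar Q}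
--   (x,y,z) ↦ (x, xz - (q₁ + q₂y + y²), z'),  where z' is the polynomial
--   z' = x z² - 2 z w + q₁ z + (q₂ + y)(y z - x² - p₂ x - p₁),  w = q₁ + q₂ y + y²,
-- which is the unique regular function with x y' z' = P(x) + bar Q(y') - 1
-- (it equals (y + y'² + q₁y' + q₂)/x on S_{P,Q}).
σx : LPoint → LPoint
σx (c , (x , y , z)) =
  let w = q₁ c + q₂ c * y + y * y in
  (barQ c , (x , x * z - w ,
     x * z * z - + 2 * z * w + q₁ c * z + (q₂ c + y) * (y * z - x * x - p₂ c * x - p₁ c)))

σy : LPoint → LPoint
σy (c , (x , y , z)) =
  let v = p₁ c + p₂ c * x + x * x in
  (barP c , (y * z - v , y ,
     y * z * z - + 2 * z * v + p₁ c * z + (p₂ c + x) * (x * z - y * y - q₂ c * y - q₁ c)))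

data Step : LPoint → LPoint → Set where
  stepx : ∀ p → Step p (σx p)
  stepy : ∀ p → Step p (σy p)

InOrbit : LPoint → LPoint → Set
InOrbit p q = Star Step p q

FiniteSet : {A : Set} → (A → Set) → Set
FiniteSet {A} S = ∃ λ (xs : List A) → ∀ a → S a → a ∈ xs

InfiniteSet : {A : Set} → (A → Set) → Set
InfiniteSet S = FiniteSet S → Data.Empty.⊥
  where import Data.Empty

IsUnit : ℤ → Set
IsUnit x = (x ≡ + 1) Data.Sum.⊎ (x ≡ - + 1)
  where import Data.Sum

{-# OPTIONS --safe #-}
-- On S_{P,Q} the point σx(x, y, z) has second coordinate y′ with y·y′ = P(x) (Vieta), so
-- |y|·|y′| ≥ |x|³ − |p₂||x|² − |p₁||x| − 1.  Hence once |x| exceeds |y| and a bound K of both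
-- coefficient sums, σx produces |y′| > |x|, and after exchanging the roles of x and y (σy is σx
-- conjugated by the swap) the same holds again: alternating σx and σy makes |x| grow forever.
-- Assume by symmetry K = |a₂| + |a₁| ≥ |b₂| + |b₁|.  Since P(1) − 2 = a₂ + a₁ and P(−1) = a₂ − a₁,
-- some x₀ = ±1 has m = |P(x₀)| ≥ K − 2; since Q̄(v) − Q̄(−v) = 2v³ + 2b₂v, some y₀ = ±1 makes the
-- x-coordinate X = |Q̄(y₀ P(x₀))| of σy(σx(x₀, y₀, z₀)) at least m³ − Km.  With K ≥ 7, so m ≥ 5,
-- this gives X > m + 2 ≥ K, which starts the climb.
module Submission where

open import Defs
open import Data.Bool using (Bool)
open import Data.Nat using (_≥_; _⊔_)
open import Data.Integer using (ℤ; ∣_∣)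
open import Data.Product using (Σ; _×_; _,_)
import Data.Nat

open import Data.Bool using (false)
open import Data.Empty using (⊥-elim)
open import Data.List using (map)
open import Data.List.Extrema.Nat using (max; xs≤max)
open import Data.List.Membership.Propositional.Properties using (∈-map⁺)
import Data.List.Relation.Unary.All as All
open import Data.Nat as ℕ using (ℕ; zero; suc; _≤_; _<_; z≤n; s≤s)
open import Data.Nat.Properties
open import Data.Integer using (+_; -_; -[1+_])
import Data.Integer.Properties as ℤ
open import Data.Product using (∃; proj₁)
open import Data.Sum using (_⊎_; inj₁; inj₂; [_,_]′)
open import Relation.Binary.PropositionalEquality
open import Relation.Binary.Construct.Closure.ReflexiveTransitive using (ε; _◅_; _◅◅_; gmap)
open import Relation.Nullary using (yes; no)

module _ where
  open Data.Nat using (_+_; _*_)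
  open import Data.Nat.Tactic.RingSolver using (solve-∀)
  open ≤-Reasoning

  private
    cube-suc : ∀ t → (1 + t) * (1 + t) * (1 + t) ≡ t * (1 + t) * (1 + t) + t * (1 + t) + (1 + t)
    cube-suc = solve-∀

    distrib-square : ∀ b a t → (b + a) * t * t ≡ b * t * t + a * t * t
    distrib-square = solve-∀

    regroup : ∀ a b c → a + b + 2 * c ≡ (a + c) + (b + c)
    regroup = solve-∀

    double : ∀ m → m + m ≡ 2 * m
    double = solve-∀

  cube-escape : ∀ {T S U A B} → T * T * T ≤ S * U + B * T * T + A * T + 1 →
                B + A < T → 1 < T → S < T → T < U
  cube-escape {suc t} {S} {U} {A} {B} h (s≤s B+A≤t) 1<T (s≤s S≤t) with U ≤? suc t
  ... | no U≰T = ≰⇒> U≰T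
  ... | yes U≤T = ⊥-elim (<⇒≱ 1<T (+-cancelˡ-≤ (t * T * T + t * T) T 1 T³≤))
    where
    T = suc t

    lower : B * T * T + A * T ≤ t * T * T
    lower = begin
      B * T * T + A * T      ≤⟨ +-monoʳ-≤ (B * T * T) (m≤m*n (A * T) T) ⟩
      B * T * T + A * T * T  ≡⟨ distrib-square B A T ⟨
      (B + A) * T * T        ≤⟨ *-monoˡ-≤ T (*-monoˡ-≤ T B+A≤t) ⟩
      t * T * T              ∎

    T³≤ : t * T * T + t * T + T ≤ t * T * T + t * T + 1
    T³≤ = begin
      t * T * T + t * T + T            ≡⟨ cube-suc t ⟨
      T * T * T                        ≤⟨ h ⟩
      S * U + B * T * T + A * T + 1    ≡⟨ cong (_+ 1) (+-assoc (S * U) (B * T * T) (A * T)) ⟩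
      S * U + (B * T * T + A * T) + 1  ≤⟨ +-monoˡ-≤ 1 (+-mono-≤ (*-mono-≤ S≤t U≤T) lower) ⟩
      t * T + t * T * T + 1            ≡⟨ cong (_+ 1) (+-comm (t * T) (t * T * T)) ⟩
      t * T * T + t * T + 1            ∎

  ≤-sum⇒≤-either : ∀ {M A B C} → 2 * M ≤ A + B + 2 * C → M ≤ A + C ⊎ M ≤ B + C
  ≤-sum⇒≤-either {M} {A} {B} {C} h with M ≤? A + C | M ≤? B + C
  ... | yes M≤A+C | _         = inj₁ M≤A+C
  ... | no _      | yes M≤B+C = inj₂ M≤B+C
  ... | no M≰A+C  | no M≰B+C  = ⊥-elim (<⇒≱ sum<2M h)
    where
    sum<2M : A + B + 2 * C < 2 * M
    sum<2M = subst₂ _<_ (sym (regroup A B C)) (double M) (+-mono-< (≰⇒> M≰A+C) (≰⇒> M≰B+C))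

  private
    cube-5+ : ∀ j → (5 + j) * (5 + j) * (5 + j)
                  ≡ ((5 + j) + 2) * (5 + j) + (1 + ((5 + j) + 2)) + (82 + 62 * j + 14 * j * j + j * j * j)
    cube-5+ = solve-∀

    square≤cube : ∀ {m} → 5 ≤ m → (m + 2) * m + (1 + (m + 2)) ≤ m * m * m
    square≤cube 5≤m with m≤n⇒∃[o]m+o≡n 5≤m
    ... | j , refl = subst (((5 + j) + 2) * (5 + j) + (1 + ((5 + j) + 2)) ≤_) (sym (cube-5+ j)) (m≤m+n _ _)

  cube-dominates : ∀ {m K X} → 7 ≤ K → K ≤ m + 2 → m * m * m ≤ X + K * m → m + 2 < X
  cube-dominates {m} {K} {X} 7≤K K≤m+2 h = +-cancelˡ-≤ (K * m) (1 + (m + 2)) X (begin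
    K * m + (1 + (m + 2))        ≤⟨ +-monoˡ-≤ (1 + (m + 2)) (*-monoˡ-≤ m K≤m+2) ⟩
    (m + 2) * m + (1 + (m + 2))  ≤⟨ square≤cube (+-cancelʳ-≤ 2 5 m (≤-trans 7≤K K≤m+2)) ⟩
    m * m * m                    ≤⟨ h ⟩
    X + K * m                    ≡⟨ +-comm X (K * m) ⟩
    K * m + X                    ∎)

open Data.Integer using (_+_; _-_; _*_)
open import Data.Integer.Tactic.RingSolver using (solve-∀)

-- polyP c and polyQ c are definitionally cubic (p₁ c) (p₂ c) and cubic (q₁ c) (q₂ c).
cubic : ℤ → ℤ → ℤ → ℤ
cubic a b t = t * t * t + b * t * t + a * t + + 1

swapPQ : Coeffs → Coeffs
swapPQ c = coeffs (q₁ c) (q₂ c) (p₁ c) (p₂ c)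

swapXY : LPoint → LPoint
swapXY (c , (x , y , z)) = swapPQ c , (y , x , z)

xOf yOf : LPoint → ℤ
xOf (_ , (x , _ , _)) = x
yOf (_ , (_ , y , _)) = y

OnItsSurface : LPoint → Set
OnItsSurface (c , p) = OnSurface c p

private
  σx-cofactor : ℤ → ℤ → ℤ → ℤ → ℤ → ℤ
  σx-cofactor b₁ b₂ x y z =
    + 1 - b₁ * b₂ - y * b₂ * b₂ - y * b₁ - + 2 * y * y * b₂ - y * y * y + x * z * b₂ + x * y * z

  σx-defect : ∀ (a₁ a₂ b₁ b₂ x y z : ℤ) →
    let w  = b₁ + b₂ * y + y * y
        y′ = x * z - w
        z′ = x * z * z - + 2 * z * w + b₁ * z + (b₂ + y) * (y * z - x * x - a₂ * x - a₁)
    in x * y′ * z′ - ((x * x * x + a₂ * x * x + a₁ * x + + 1) + (y′ * y′ * y′ + b₁ * y′ * y′ + b₂ * y′ + + 1) - + 1)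
       ≡ (+ 1 - b₁ * b₂ - y * b₂ * b₂ - y * b₁ - + 2 * y * y * b₂ - y * y * y + x * z * b₂ + x * y * z)
         * (x * y * z - ((x * x * x + a₂ * x * x + a₁ * x + + 1) + (y * y * y + b₂ * y * y + b₁ * y + + 1) - + 1))
  σx-defect = solve-∀

  σx-vieta-identity : ∀ (a₁ a₂ b₁ b₂ x y z : ℤ) →
    y * (x * z - (b₁ + b₂ * y + y * y))
      ≡ (x * x * x + a₂ * x * x + a₁ * x + + 1)
        + (x * y * z - ((x * x * x + a₂ * x * x + a₁ * x + + 1) + (y * y * y + b₂ * y * y + b₁ * y + + 1) - + 1))
  σx-vieta-identity = solve-∀

≡-from-defect-multiple : ∀ {l r l′ r′} k → l′ - r′ ≡ k * (l - r) → l ≡ r → l′ ≡ r′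
≡-from-defect-multiple {l} {_} {l′} {r′} k eq refl =
  ℤ.i-j≡0⇒i≡j l′ r′ (trans eq (trans (cong (k *_) (ℤ.+-inverseʳ l)) (ℤ.*-zeroʳ k)))

σx-OnSurface : ∀ p → OnItsSurface p → OnItsSurface (σx p)
σx-OnSurface (c , (x , y , z)) =
  ≡-from-defect-multiple (σx-cofactor (q₁ c) (q₂ c) x y z) (σx-defect (p₁ c) (p₂ c) (q₁ c) (q₂ c) x y z)

swapXY-OnSurface : ∀ p → OnItsSurface p → OnItsSurface (swapXY p)
swapXY-OnSurface (c , (x , y , z)) on = begin
  y * x * z                    ≡⟨ cong (_* z) (ℤ.*-comm y x) ⟩
  x * y * z                    ≡⟨ on ⟩
  polyP c x + polyQ c y - + 1  ≡⟨ cong (_- + 1) (ℤ.+-comm (polyP c x) (polyQ c y)) ⟩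
  polyQ c y + polyP c x - + 1  ∎
  where open ≡-Reasoning

σy-via-σx : ∀ p → σy p ≡ swapXY (σx (swapXY p))
σy-via-σx p = refl

σy-OnSurface : ∀ p → OnItsSurface p → OnItsSurface (σy p)
σy-OnSurface p on =
  subst OnItsSurface (sym (σy-via-σx p))
    (swapXY-OnSurface (σx (swapXY p)) (σx-OnSurface (swapXY p) (swapXY-OnSurface p on)))

σx-vieta : ∀ p → OnItsSurface p → yOf p * yOf (σx p) ≡ polyP (proj₁ p) (xOf p)
σx-vieta (c , (x , y , z)) on =
  trans (σx-vieta-identity (p₁ c) (p₂ c) (q₁ c) (q₂ c) x y z)
        (trans (cong (_+_ (polyP c x)) (ℤ.i≡j⇒i-j≡0 on)) (ℤ.+-identityʳ (polyP c x)))

σy-vieta : ∀ p → OnItsSurface p → xOf p * xOf (σy p) ≡ polyQ (proj₁ p) (yOf p)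
σy-vieta p on = σx-vieta (swapXY p) (swapXY-OnSurface p on)

unit*unit≡1 : ∀ {u} → IsUnit u → u * u ≡ + 1
unit*unit≡1 (inj₁ refl) = refl
unit*unit≡1 (inj₂ refl) = refl

∣unit*i∣≡∣i∣ : ∀ {u} → IsUnit u → ∀ i → ∣ u * i ∣ ≡ ∣ i ∣
∣unit*i∣≡∣i∣ (inj₁ refl) i = cong ∣_∣ (ℤ.*-identityˡ i)
∣unit*i∣≡∣i∣ (inj₂ refl) i = trans (cong ∣_∣ (ℤ.-1*i≡-i i)) (ℤ.∣-i∣≡∣i∣ i)

unit*-solve : ∀ {u w t} → IsUnit u → u * w ≡ t → w ≡ u * t
unit*-solve {u} {w} uu refl = begin
  w            ≡⟨ ℤ.*-identityˡ w ⟨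
  + 1 * w      ≡⟨ cong (_* w) (unit*unit≡1 uu) ⟨
  u * u * w    ≡⟨ ℤ.*-assoc u u w ⟩
  u * (u * w)  ∎
  where open ≡-Reasoning

trivialZ : Coeffs → ℤ → ℤ → ℤ
trivialZ c x y = x * y * (polyP c x + polyQ c y - + 1)

private
  regroup-squares : ∀ x y r → x * y * (x * y * r) ≡ (x * x) * (y * y) * r
  regroup-squares = solve-∀

trivial-OnSurface : ∀ c {x y} → IsUnit x → IsUnit y → OnSurface c (x , y , trivialZ c x y)
trivial-OnSurface c {x} {y} ux uy = begin
  x * y * (x * y * r)    ≡⟨ regroup-squares x y r ⟩
  (x * x) * (y * y) * r  ≡⟨ cong₂ (λ s t → s * t * r) (unit*unit≡1 ux) (unit*unit≡1 uy) ⟩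
  + 1 * r                ≡⟨ ℤ.*-identityˡ r ⟩
  r                      ∎
  where
  open ≡-Reasoning
  r = polyP c x + polyQ c y - + 1

∣i-j-k∣≤∣i∣+∣j∣+∣k∣ : ∀ i j k → ∣ i - j - k ∣ ≤ ∣ i ∣ ℕ.+ ∣ j ∣ ℕ.+ ∣ k ∣
∣i-j-k∣≤∣i∣+∣j∣+∣k∣ i j k =
  ≤-trans (ℤ.∣i-j∣≤∣i∣+∣j∣ (i - j) k) (+-monoˡ-≤ ∣ k ∣ (ℤ.∣i-j∣≤∣i∣+∣j∣ i j))

∣i*j*k∣≡∣i∣*∣j∣*∣k∣ : ∀ i j k → ∣ i * j * k ∣ ≡ ∣ i ∣ ℕ.* ∣ j ∣ ℕ.* ∣ k ∣
∣i*j*k∣≡∣i∣*∣j∣*∣k∣ i j k = trans (ℤ.abs-* (i * j) k) (cong (ℕ._* ∣ k ∣) (ℤ.abs-* i j))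

private
  cube-from-cubic : ∀ a b t → t * t * t ≡ (t * t * t + b * t * t + a * t + + 1) - b * t * t - a * t - + 1
  cube-from-cubic = solve-∀

vieta-partner-escapes : ∀ a b t s u → s * u ≡ cubic a b t →
  ∣ b ∣ ℕ.+ ∣ a ∣ < ∣ t ∣ → 1 < ∣ t ∣ → ∣ s ∣ < ∣ t ∣ → ∣ t ∣ < ∣ u ∣
vieta-partner-escapes a b t s u su≡ = cube-escape {A = ∣ a ∣} {B = ∣ b ∣} (begin
  ∣ t ∣ ℕ.* ∣ t ∣ ℕ.* ∣ t ∣
    ≡⟨ ∣i*j*k∣≡∣i∣*∣j∣*∣k∣ t t t ⟨
  ∣ t * t * t ∣
    ≡⟨ cong ∣_∣ (trans (cube-from-cubic a b t) (cong (λ v → v - b * t * t - a * t - + 1) (sym su≡))) ⟩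
  ∣ s * u - b * t * t - a * t - + 1 ∣
    ≤⟨ ≤-trans (ℤ.∣i-j∣≤∣i∣+∣j∣ (s * u - b * t * t - a * t) (+ 1))
               (+-monoˡ-≤ 1 (∣i-j-k∣≤∣i∣+∣j∣+∣k∣ (s * u) (b * t * t) (a * t))) ⟩
  ∣ s * u ∣ ℕ.+ ∣ b * t * t ∣ ℕ.+ ∣ a * t ∣ ℕ.+ 1
    ≡⟨ cong₂ (λ m n → m ℕ.+ n ℕ.+ ∣ a * t ∣ ℕ.+ 1) (ℤ.abs-* s u) (∣i*j*k∣≡∣i∣*∣j∣*∣k∣ b t t) ⟩
  ∣ s ∣ ℕ.* ∣ u ∣ ℕ.+ ∣ b ∣ ℕ.* ∣ t ∣ ℕ.* ∣ t ∣ ℕ.+ ∣ a * t ∣ ℕ.+ 1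
    ≡⟨ cong (λ o → ∣ s ∣ ℕ.* ∣ u ∣ ℕ.+ ∣ b ∣ ℕ.* ∣ t ∣ ℕ.* ∣ t ∣ ℕ.+ o ℕ.+ 1) (ℤ.abs-* a t) ⟩
  ∣ s ∣ ℕ.* ∣ u ∣ ℕ.+ ∣ b ∣ ℕ.* ∣ t ∣ ℕ.* ∣ t ∣ ℕ.+ ∣ a ∣ ℕ.* ∣ t ∣ ℕ.+ 1 ∎)
  where open ≤-Reasoning

∣i∣+∣j∣≤∣i-j∣⊎∣i+j∣ : ∀ i j → ∣ i ∣ ℕ.+ ∣ j ∣ ≤ ∣ i - j ∣ ⊎ ∣ i ∣ ℕ.+ ∣ j ∣ ≤ ∣ i + j ∣
∣i∣+∣j∣≤∣i-j∣⊎∣i+j∣ (+ m)     (+ n)     = inj₂ ≤-refl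
∣i∣+∣j∣≤∣i-j∣⊎∣i+j∣ (+ m)     -[1+ n ]  = inj₁ ≤-refl
∣i∣+∣j∣≤∣i-j∣⊎∣i+j∣ -[1+ m ]  (+ n)     =
  inj₁ (≤-reflexive (trans (+-comm (suc m) n) (ℤ.∣i-j∣≡∣j-i∣ (+ n) -[1+ m ])))
∣i∣+∣j∣≤∣i-j∣⊎∣i+j∣ -[1+ m ]  -[1+ n ]  = inj₂ (s≤s (≤-reflexive (+-suc m n)))

private
  cubic-at-−1 : ∀ a b → (- + 1) * (- + 1) * (- + 1) + b * (- + 1) * (- + 1) + a * (- + 1) + + 1 ≡ b - a
  cubic-at-−1 = solve-∀

  cubic-at-1 : ∀ a b → b + a ≡ (+ 1 * + 1 * + 1 + b * + 1 * + 1 + a * + 1 + + 1) - + 2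
  cubic-at-1 = solve-∀

  cubic-odd-part : ∀ a b v →
    + 2 * (v * v * v) ≡ (v * v * v + b * v * v + a * v + + 1)
                        - ((- v) * (- v) * (- v) + b * (- v) * (- v) + a * (- v) + + 1) - + 2 * (a * v)
  cubic-odd-part = solve-∀

cubic-large-at-unit : ∀ a b → ∃ λ u → IsUnit u × ∣ b ∣ ℕ.+ ∣ a ∣ ≤ ∣ cubic a b u ∣ ℕ.+ 2
cubic-large-at-unit a b with ∣i∣+∣j∣≤∣i-j∣⊎∣i+j∣ b a
... | inj₁ ≤∣b-a∣ = - + 1 , inj₂ refl ,
  ≤-trans ≤∣b-a∣ (≤-trans (≤-reflexive (cong ∣_∣ (sym (cubic-at-−1 a b)))) (m≤m+n _ 2))
... | inj₂ ≤∣b+a∣ = + 1 , inj₁ refl ,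
  ≤-trans ≤∣b+a∣ (≤-trans (≤-reflexive (cong ∣_∣ (cubic-at-1 a b))) (ℤ.∣i-j∣≤∣i∣+∣j∣ (cubic a b (+ 1)) (+ 2)))

cubic-odd-part-bound : ∀ a b v → 2 ℕ.* (∣ v ∣ ℕ.* ∣ v ∣ ℕ.* ∣ v ∣)
  ≤ ∣ cubic a b v ∣ ℕ.+ ∣ cubic a b (- v) ∣ ℕ.+ 2 ℕ.* (∣ a ∣ ℕ.* ∣ v ∣)
cubic-odd-part-bound a b v = begin
  2 ℕ.* (∣ v ∣ ℕ.* ∣ v ∣ ℕ.* ∣ v ∣)
    ≡⟨ trans (ℤ.abs-* (+ 2) (v * v * v)) (cong (2 ℕ.*_) (∣i*j*k∣≡∣i∣*∣j∣*∣k∣ v v v)) ⟨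
  ∣ + 2 * (v * v * v) ∣
    ≡⟨ cong ∣_∣ (cubic-odd-part a b v) ⟩
  ∣ cubic a b v - cubic a b (- v) - + 2 * (a * v) ∣
    ≤⟨ ∣i-j-k∣≤∣i∣+∣j∣+∣k∣ (cubic a b v) (cubic a b (- v)) (+ 2 * (a * v)) ⟩
  ∣ cubic a b v ∣ ℕ.+ ∣ cubic a b (- v) ∣ ℕ.+ ∣ + 2 * (a * v) ∣
    ≡⟨ cong (∣ cubic a b v ∣ ℕ.+ ∣ cubic a b (- v) ∣ ℕ.+_)
            (trans (ℤ.abs-* (+ 2) (a * v)) (cong (2 ℕ.*_) (ℤ.abs-* a v))) ⟩
  ∣ cubic a b v ∣ ℕ.+ ∣ cubic a b (- v) ∣ ℕ.+ 2 ℕ.* (∣ a ∣ ℕ.* ∣ v ∣) ∎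
  where open ≤-Reasoning

cubic-large-at-unit-multiple : ∀ a b v → ∃ λ u → IsUnit u ×
  ∣ v ∣ ℕ.* ∣ v ∣ ℕ.* ∣ v ∣ ≤ ∣ cubic a b (u * v) ∣ ℕ.+ ∣ a ∣ ℕ.* ∣ v ∣
cubic-large-at-unit-multiple a b v =
  [ (λ large-at-v  → + 1   , inj₁ refl , subst LargeAt (sym (ℤ.*-identityˡ v)) large-at-v)
  , (λ large-at-−v → - + 1 , inj₂ refl , subst LargeAt (sym (ℤ.-1*i≡-i v)) large-at-−v)
  ]′ (≤-sum⇒≤-either {B = ∣ cubic a b (- v) ∣} {C = ∣ a ∣ ℕ.* ∣ v ∣} (cubic-odd-part-bound a b v))
  where
  LargeAt : ℤ → Set
  LargeAt w = ∣ v ∣ ℕ.* ∣ v ∣ ℕ.* ∣ v ∣ ≤ ∣ cubic a b w ∣ ℕ.+ ∣ a ∣ ℕ.* ∣ v ∣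

record CoeffBound (K : ℕ) (c : Coeffs) : Set where
  constructor coeffBound
  field
    p-bound : ∣ p₂ c ∣ ℕ.+ ∣ p₁ c ∣ ≤ K
    q-bound : ∣ q₂ c ∣ ℕ.+ ∣ q₁ c ∣ ≤ K

CoeffBound-barP : ∀ {K c} → CoeffBound K c → CoeffBound K (barP c)
CoeffBound-barP {K} {c} (coeffBound p-bound q-bound) =
  coeffBound (subst (_≤ K) (+-comm ∣ p₂ c ∣ ∣ p₁ c ∣) p-bound) q-bound

CoeffBound-barQ : ∀ {K c} → CoeffBound K c → CoeffBound K (barQ c)
CoeffBound-barQ {K} {c} (coeffBound p-bound q-bound) =
  coeffBound p-bound (subst (_≤ K) (+-comm ∣ q₂ c ∣ ∣ q₁ c ∣) q-bound)

CoeffBound-swapPQ : ∀ {K c} → CoeffBound K c → CoeffBound K (swapPQ c)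
CoeffBound-swapPQ (coeffBound p-bound q-bound) = coeffBound q-bound p-bound

record Escaping (K : ℕ) (p : LPoint) : Set where
  constructor escaping
  field
    on-surface : OnItsSurface p
    bounded    : CoeffBound K (proj₁ p)
    y<x        : ∣ yOf p ∣ < ∣ xOf p ∣
    K<x        : K < ∣ xOf p ∣

escaping-step : ∀ {K} → 1 ≤ K → ∀ {p} → Escaping K p →
  Escaping K (swapXY (σx p)) × ∣ xOf p ∣ < ∣ xOf (swapXY (σx p)) ∣
escaping-step 1≤K {p} (escaping on bounded y<x K<x) =
  escaping (swapXY-OnSurface (σx p) (σx-OnSurface p on)) (CoeffBound-swapPQ (CoeffBound-barQ bounded))
           x<y′ (<-trans K<x x<y′) ,
  x<y′
  where
  x<y′ : ∣ xOf p ∣ < ∣ yOf (σx p) ∣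
  x<y′ = vieta-partner-escapes (p₁ (proj₁ p)) (p₂ (proj₁ p)) (xOf p) (yOf p) (yOf (σx p)) (σx-vieta p on)
          (≤-<-trans (CoeffBound.p-bound bounded) K<x) (≤-<-trans 1≤K K<x) y<x

escaping-σyσx : ∀ {K} → 1 ≤ K → ∀ {p} → Escaping K p →
  Escaping K (σy (σx p)) × ∣ xOf p ∣ < ∣ xOf (σy (σx p)) ∣
escaping-σyσx {K} 1≤K {p} e =
  let e′ , growth  = escaping-step 1≤K e
      e″ , growth′ = escaping-step 1≤K e′
  in subst (λ q → Escaping K q × ∣ xOf p ∣ < ∣ xOf q ∣) (sym (σy-via-σx (σx p)))
           (e″ , <-trans growth growth′)

escaping-climbs : ∀ {K} → 1 ≤ K → ∀ {p} → Escaping K p →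
  ∀ n → ∃ λ q → InOrbit p q × Escaping K q × n ≤ ∣ xOf q ∣
escaping-climbs 1≤K {p} e zero = p , ε , e , z≤n
escaping-climbs 1≤K e (suc n) =
  let q , p→q , e-q , n≤x = escaping-climbs 1≤K e n
      e′ , growth         = escaping-σyσx 1≤K e-q
  in σy (σx q) , p→q ◅◅ stepx q ◅ stepy (σx q) ◅ ε , e′ , ≤-<-trans n≤x growth

unbounded⇒infinite : ∀ {A : Set} {S : A → Set} (f : A → ℕ) →
  (∀ n → ∃ λ a → S a × n ≤ f a) → InfiniteSet S
unbounded⇒infinite f unbounded (xs , covers) with unbounded (suc (max 0 (map f xs)))
... | a , Sa , n≤fa =
  <-irrefl refl (<-≤-trans n≤fa (All.lookup (xs≤max 0 (map f xs)) (∈-map⁺ f (covers a Sa))))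

escaping⇒infinite-orbit : ∀ {K p} → 1 ≤ K → Escaping K p → InfiniteSet (InOrbit p)
escaping⇒infinite-orbit 1≤K e = unbounded⇒infinite (λ q → ∣ xOf q ∣)
  (λ n → let q , p→q , _ , n≤x = escaping-climbs 1≤K e n in q , p→q , n≤x)

infinite-orbit-backward : ∀ {p q} → InOrbit p q → InfiniteSet (InOrbit q) → InfiniteSet (InOrbit p)
infinite-orbit-backward p→q infinite (xs , covers) = infinite (xs , λ r q→r → covers r (p→q ◅◅ q→r))

Step-swapXY : ∀ {p q} → Step p q → Step (swapXY p) (swapXY q)
Step-swapXY (stepx p) = stepy (swapXY p)
Step-swapXY (stepy p) = stepx (swapXY p)

infinite-orbit-swapXY : ∀ {p} → InfiniteSet (InOrbit p) → InfiniteSet (InOrbit (swapXY p))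
infinite-orbit-swapXY infinite (xs , covers) =
  infinite (map swapXY xs , λ q p→q → ∈-map⁺ swapXY (covers (swapXY q) (gmap swapXY Step-swapXY p→q)))

trivial-point-escapes : ∀ {K c x₀ y₀} → CoeffBound K c → 7 ≤ K → IsUnit x₀ → IsUnit y₀ →
  K ≤ ∣ polyP c x₀ ∣ ℕ.+ 2 →
  ∣ polyP c x₀ ∣ ℕ.* ∣ polyP c x₀ ∣ ℕ.* ∣ polyP c x₀ ∣
    ≤ ∣ polyQ (barQ c) (y₀ * polyP c x₀) ∣ ℕ.+ K ℕ.* ∣ polyP c x₀ ∣ →
  Escaping K (σy (σx (c , (x₀ , y₀ , trivialZ c x₀ y₀))))
trivial-point-escapes {K} {c} {x₀} {y₀} bounded 7≤K ux uy K≤m+2 m³≤ =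
  escaping on₂ (CoeffBound-barP (CoeffBound-barQ bounded))
           (subst₂ _<_ (sym ∣y₂∣≡m) (sym ∣x₂∣≡X) (≤-<-trans (m≤m+n m 2) m+2<X))
           (subst (K <_) (sym ∣x₂∣≡X) (≤-<-trans K≤m+2 m+2<X))
  where
  v = polyP c x₀
  m = ∣ v ∣
  p₀ = c , (x₀ , y₀ , trivialZ c x₀ y₀)
  on₀ = trivial-OnSurface c ux uy
  on₁ = σx-OnSurface p₀ on₀
  on₂ = σy-OnSurface (σx p₀) on₁

  y₁≡ : yOf (σx p₀) ≡ y₀ * v
  y₁≡ = unit*-solve uy (σx-vieta p₀ on₀)

  ∣y₂∣≡m : ∣ yOf (σy (σx p₀)) ∣ ≡ m
  ∣y₂∣≡m = trans (cong ∣_∣ y₁≡) (∣unit*i∣≡∣i∣ uy v)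

  ∣x₂∣≡X : ∣ xOf (σy (σx p₀)) ∣ ≡ ∣ polyQ (barQ c) (y₀ * v) ∣
  ∣x₂∣≡X = begin
    ∣ xOf (σy (σx p₀)) ∣                   ≡⟨ cong ∣_∣ (unit*-solve ux (σy-vieta (σx p₀) on₁)) ⟩
    ∣ x₀ * polyQ (barQ c) (yOf (σx p₀)) ∣  ≡⟨ ∣unit*i∣≡∣i∣ ux _ ⟩
    ∣ polyQ (barQ c) (yOf (σx p₀)) ∣       ≡⟨ cong (λ y → ∣ polyQ (barQ c) y ∣) y₁≡ ⟩
    ∣ polyQ (barQ c) (y₀ * v) ∣            ∎
    where open ≡-Reasoning

  m+2<X : m ℕ.+ 2 < ∣ polyQ (barQ c) (y₀ * v) ∣
  m+2<X = cube-dominates 7≤K K≤m+2 m³≤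

TrivialInfiniteOrbit : Coeffs → Set
TrivialInfiniteOrbit c = Σ ℤ λ x₀ → Σ ℤ λ y₀ → Σ ℤ λ z₀ →
  IsUnit x₀ × IsUnit y₀ × OnSurface c (x₀ , y₀ , z₀) × InfiniteSet (InOrbit (c , (x₀ , y₀ , z₀)))

trivial-infinite-orbit : ∀ c → 7 ≤ ∣ p₂ c ∣ ℕ.+ ∣ p₁ c ∣ →
  ∣ q₂ c ∣ ℕ.+ ∣ q₁ c ∣ ≤ ∣ p₂ c ∣ ℕ.+ ∣ p₁ c ∣ → TrivialInfiniteOrbit c
trivial-infinite-orbit c 7≤K q-bound = from-x₀ (cubic-large-at-unit (p₁ c) (p₂ c))
  where
  K = ∣ p₂ c ∣ ℕ.+ ∣ p₁ c ∣

  from-y₀ : ∀ {x₀} → IsUnit x₀ → K ≤ ∣ polyP c x₀ ∣ ℕ.+ 2 → let m = ∣ polyP c x₀ ∣ in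
    (∃ λ y₀ → IsUnit y₀ × m ℕ.* m ℕ.* m ≤ ∣ polyQ (barQ c) (y₀ * polyP c x₀) ∣ ℕ.+ ∣ q₂ c ∣ ℕ.* m) →
    TrivialInfiniteOrbit c
  from-y₀ {x₀} ux K≤m+2 (y₀ , uy , m³≤) =
    x₀ , y₀ , trivialZ c x₀ y₀ , ux , uy , trivial-OnSurface c ux uy ,
    infinite-orbit-backward (stepx p₀ ◅ stepy (σx p₀) ◅ ε)
                            (escaping⇒infinite-orbit (≤-trans (s≤s z≤n) 7≤K) escapes)
    where
    p₀ = c , (x₀ , y₀ , trivialZ c x₀ y₀)
    m = ∣ polyP c x₀ ∣
    ∣q₂∣≤K : ∣ q₂ c ∣ ≤ K
    ∣q₂∣≤K = ≤-trans (m≤m+n ∣ q₂ c ∣ ∣ q₁ c ∣) q-bound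
    escapes : Escaping K (σy (σx p₀))
    escapes = trivial-point-escapes (coeffBound ≤-refl q-bound) 7≤K ux uy K≤m+2
                (≤-trans m³≤ (+-monoʳ-≤ ∣ polyQ (barQ c) (y₀ * polyP c x₀) ∣ (*-monoˡ-≤ m ∣q₂∣≤K)))

  from-x₀ : (∃ λ x₀ → IsUnit x₀ × K ≤ ∣ polyP c x₀ ∣ ℕ.+ 2) → TrivialInfiniteOrbit c
  from-x₀ (x₀ , ux , K≤m+2) = from-y₀ ux K≤m+2 (cubic-large-at-unit-multiple (q₂ c) (q₁ c) (polyP c x₀))

TrivialInfiniteOrbit-swapPQ : ∀ c → TrivialInfiniteOrbit (swapPQ c) → TrivialInfiniteOrbit c
TrivialInfiniteOrbit-swapPQ c (x₀ , y₀ , z₀ , ux , uy , on , infinite) =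
  y₀ , x₀ , z₀ , uy , ux , swapXY-OnSurface (swapPQ c , (x₀ , y₀ , z₀)) on , infinite-orbit-swapXY infinite

corollary11 : (a₁ a₂ b₁ b₂ : ℤ) →
    (∣ a₂ ∣ Data.Nat.+ ∣ a₁ ∣) ⊔ (∣ b₂ ∣ Data.Nat.+ ∣ b₁ ∣) ≥ 7 →
    Σ Bool λ sA → Σ Bool λ sB → Σ ℤ λ x₀ → Σ ℤ λ y₀ → Σ ℤ λ z₀ →
      IsUnit x₀ × IsUnit y₀ ×
      OnSurface (companion (surf a₁ a₂ b₁ b₂) sA sB) (x₀ , y₀ , z₀) ×
      InfiniteSet (InOrbit (companion (surf a₁ a₂ b₁ b₂) sA sB , (x₀ , y₀ , z₀)))
corollary11 a₁ a₂ b₁ b₂ 7≤max = false , false , on-S (≤-total B A)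
  where
  c = surf a₁ a₂ b₁ b₂
  A = ∣ a₂ ∣ ℕ.+ ∣ a₁ ∣
  B = ∣ b₂ ∣ ℕ.+ ∣ b₁ ∣
  on-S : B ≤ A ⊎ A ≤ B → TrivialInfiniteOrbit c
  on-S (inj₁ B≤A) = trivial-infinite-orbit c (subst (7 ≤_) (m≥n⇒m⊔n≡m B≤A) 7≤max) B≤A
  on-S (inj₂ A≤B) = TrivialInfiniteOrbit-swapPQ c
    (trivial-infinite-orbit (swapPQ c) (subst (7 ≤_) (m≤n⇒m⊔n≡n A≤B) 7≤max) A≤B)
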